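{- For any fixed relation $R$, recursion variable $X$, valuation $\mathbb{V}$ and chop formulas $\Psi,\, \Psi' \in CF_{(R,X)}$, if $L(gr(\Psi')) \subseteq L(gr(\Psi))$, then $[\![\mu X. \Psi']\!]_{\mathbb{V}} \subseteq [\![\mu X. \Psi]\!]_{\mathbb{V}}$.
   Context: Trace formulas are generated by $\Phi ::= p \mid R \mid \Phi \land \Phi \mid \Phi \lor \Phi \mid \Phi \frown \Phi \mid X \mid \mu X.\Phi$ ($\frown$ is chop), with semantics $[\![\Phi]\!]_{\mathbb{V}}$ a set of finite traces under valuation $\mathbb{V}$ of recursion variables, where $[\![\Phi_1\frown\Phi_2]\!]_{\mathbb{V}} = \{\sigma\cdot s\cdot\sigma' \mid \sigma\cdot s\in[\![\Phi_1]\!]_{\mathbb{V}},\ s\cdot\sigma'\in[\![\Phi_2]\!]_{\mathbb{V}}\}$ and $\mu$ denotes least fixed point. For fixed $R$ and $X$, primitive chop formulas are chop sequences built only from $R$ and $X$, and chop formulas $CF_{(R,X)}$ are finite disjunctions of primitive chop formulas (with $X$ free). For $\Psi=\bigvee_i\varphi_i\in CF_{(R,X)}$, $gr(\Psi)$ is the context-free grammar with non-terminal and start symbol $X$, terminal $R$, and productions $X\to grammatize(\varphi_i)$, where $grammatize(S_1\frown\cdots\frown S_n) = S_1\cdots S_n$; $L(gr(\Psi))$ is its language. -}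

module Defs where

open import Data.Nat using (ℕ)
open import Data.List using (List; []; _∷_; _++_; [_]; map)
open import Data.List.NonEmpty using (List⁺; _∷_; toList)
open import Data.List.Membership.Propositional using (_∈_)
open import Relation.Binary.PropositionalEquality using (_≡_; _≢_)
open import Relation.Binary.Construct.Closure.ReflexiveTransitive using (Star)
open import Level using (suc; zero)

data Form (S : Set) : Set₁ where
  pred : (S → Set) → Form S
  rel  : (S → S → Set) → Form S
  _∧ᶠ_ : Form S → Form S → Form S
  _∨ᶠ_ : Form S → Form S → Form S
  _⌢_  : Form S → Form S → Form S
  var  : ℕ → Form S
  μ    : ℕ → Form S → Form S

Trace : Set → Set
Trace S = List S

Val : Set → Set₁
Val S = ℕ → Trace S → Set

-- Environments: a base valuation, extended by the binders μX.Φ in scope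
-- (each bound variable denotes the least fixed point of its binder,
-- evaluated in the environment of the binder).
data Env (S : Set) : Set₁ where
  base : Val S → Env S
  bind : ℕ → Form S → Env S → Env S

-- Satisfaction; being an inductive family, μ receives its least
-- fixed point semantics.
data Sat {S : Set} : Env S → Form S → Trace S → Set₁ where
  sat-pred  : ∀ {e p s} → p s → Sat e (pred p) [ s ]
  sat-rel   : ∀ {e R s s'} → R s s' → Sat e (rel R) (s ∷ s' ∷ [])
  sat-∧     : ∀ {e Φ₁ Φ₂ σ} → Sat e Φ₁ σ → Sat e Φ₂ σ → Sat e (Φ₁ ∧ᶠ Φ₂) σ
  sat-∨₁    : ∀ {e Φ₁ Φ₂ σ} → Sat e Φ₁ σ → Sat e (Φ₁ ∨ᶠ Φ₂) σ
  sat-∨₂    : ∀ {e Φ₁ Φ₂ σ} → Sat e Φ₂ σ → Sat e (Φ₁ ∨ᶠ Φ₂) σ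
  sat-chop  : ∀ {e Φ₁ Φ₂ σ s σ'} → Sat e Φ₁ (σ ++ [ s ]) → Sat e Φ₂ (s ∷ σ')
              → Sat e (Φ₁ ⌢ Φ₂) (σ ++ s ∷ σ')
  sat-base  : ∀ {V X σ} → V X σ → Sat (base V) (var X) σ
  sat-here  : ∀ {X Φ e σ} → Sat (bind X Φ e) Φ σ → Sat (bind X Φ e) (var X) σ
  sat-there : ∀ {X Y Φ e σ} → X ≢ Y → Sat e (var X) σ → Sat (bind Y Φ e) (var X) σ
  sat-μ     : ∀ {e X Φ σ} → Sat (bind X Φ e) Φ σ → Sat e (μ X Φ) σ

⟦_⟧ : ∀ {S} → Form S → Val S → Trace S → Set₁
⟦ Φ ⟧ V σ = Sat (base V) Φ σ

data Sym : Set where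
  𝑅 𝑋 : Sym

-- A primitive chop formula S₁ ⌢ ⋯ ⌢ Sₙ (n ≥ 1), Sᵢ ∈ {R, X}.
PrimChop : Set
PrimChop = List⁺ Sym

-- A chop formula: a finite (non-empty) disjunction of primitive chop formulas.
ChopFormula : Set
ChopFormula = List⁺ PrimChop

symForm : ∀ {S} → (S → S → Set) → ℕ → Sym → Form S
symForm R X 𝑅 = rel R
symForm R X 𝑋 = var X

chainForm : ∀ {S} → (S → S → Set) → ℕ → Sym → List Sym → Form S
chainForm R X a []       = symForm R X a
chainForm R X a (b ∷ as) = symForm R X a ⌢ chainForm R X b as

primForm : ∀ {S} → (S → S → Set) → ℕ → PrimChop → Form S
primForm R X (a ∷ as) = chainForm R X a as

disjForm : ∀ {S} → (S → S → Set) → ℕ → PrimChop → List PrimChop → Form S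
disjForm R X φ []       = primForm R X φ
disjForm R X φ (ψ ∷ φs) = primForm R X φ ∨ᶠ disjForm R X ψ φs

chopForm : ∀ {S} → (S → S → Set) → ℕ → ChopFormula → Form S
chopForm R X (φ ∷ φs) = disjForm R X φ φs

-- The grammar gr(Ψ): non-terminal/start symbol 𝑋, terminal 𝑅,
-- productions 𝑋 → grammatize(φᵢ). Sentential forms are lists of Sym.

grammatize : PrimChop → List Sym
grammatize = toList

data Step (Ψ : ChopFormula) : List Sym → List Sym → Set where
  step : ∀ α β φ → φ ∈ toList Ψ →
         Step Ψ (α ++ 𝑋 ∷ β) (α ++ grammatize φ ++ β)

data Terminal : Set where
  R : Terminal

embed : Terminal → Sym
embed R = 𝑅

L : ChopFormula → List Terminal → Set
L Ψ w = Star (Step Ψ) (𝑋 ∷ []) (map embed w)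

module Submission where

open import Defs
open import Data.Nat using (ℕ)
open import Data.List using (List; []; _∷_; _++_; [_]; map)
open import Data.List.NonEmpty as List⁺ using (_∷_)
open import Data.List.Properties using (++-assoc; ++-identityʳ; map-++)
open import Data.List.Membership.Propositional using (_∈_)
open import Data.List.Relation.Unary.Any using (here; there)
open import Data.Product using (Σ; ∃₂; _×_; _,_)
open import Data.Empty using (⊥-elim)
open import Relation.Binary.PropositionalEquality
  using (_≡_; refl; sym; trans; cong; subst; subst₂; module ≡-Reasoning)
open import Relation.Binary.Construct.Closure.ReflexiveTransitive using (Star; ε; _◅_; _◅◅_; gmap)

-- Both least fixed points denote the same kind of set: the traces s₀ s₁ ⋯ sₙ
-- with R sᵢ sᵢ₊₁ for all i whose length word Rⁿ lies in the language of the
-- grammar. Unfolding μX.Ψ' along a satisfaction derivation produces a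
-- derivation X ⇒* Rⁿ in gr(Ψ') whose leaves are single R-steps of the trace;
-- conversely, any derivation X ⇒* Rⁿ in gr(Ψ) can be replayed backwards,
-- assigning to every symbol of each sentential form a satisfied piece of the
-- trace, until only X is left.

module _ {S : Set} where

  lastOf : S → List S → S
  lastOf s []      = s
  lastOf s (x ∷ τ) = lastOf x τ

  lastOf-++ : ∀ s τ τ' → lastOf s (τ ++ τ') ≡ lastOf (lastOf s τ) τ'
  lastOf-++ s []      τ' = refl
  lastOf-++ s (x ∷ τ) τ' = lastOf-++ x τ τ'

  ∷-init-lastOf : ∀ s τ → Σ (List S) λ σ → s ∷ τ ≡ σ ++ [ lastOf s τ ]
  ∷-init-lastOf s []      = [] , refl
  ∷-init-lastOf s (x ∷ τ) with ∷-init-lastOf x τ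
  ... | σ , eq = s ∷ σ , cong (s ∷_) eq

  -- Chops P (a₁ ⋯ aₙ) s τ: the trace s ∷ τ is a chop of consecutive pieces,
  -- adjacent pieces sharing one state, with the i-th piece in P aᵢ.
  data Chops {A : Set} (P : A → List S → Set₁) : List A → S → List S → Set₁ where
    []  : ∀ {s} → Chops P [] s []
    _∷_ : ∀ {a as s τ τ'} → P a (s ∷ τ) → Chops P as (lastOf s τ) τ' →
          Chops P (a ∷ as) s (τ ++ τ')

  module _ {A : Set} {P : A → List S → Set₁} where

    Chops-++ : ∀ {as bs s τ τ'} → Chops P as s τ → Chops P bs (lastOf s τ) τ' →
               Chops P (as ++ bs) s (τ ++ τ')
    Chops-++ [] q = q
    Chops-++ {bs = bs} {s} {τ' = τ'} (_∷_ {τ = τ₁} {τ₂} p ps) q =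
      subst (Chops P _ _) (sym (++-assoc τ₁ τ₂ τ'))
        (p ∷ Chops-++ ps (subst (λ t → Chops P bs t τ') (lastOf-++ s τ₁ τ₂) q))

    Chops-split : ∀ as {bs s τ} → Chops P (as ++ bs) s τ →
                  ∃₂ λ τ₁ τ₂ → τ ≡ τ₁ ++ τ₂ × Chops P as s τ₁ × Chops P bs (lastOf s τ₁) τ₂
    Chops-split []       {τ = τ} ps = [] , τ , refl , [] , ps
    Chops-split (a ∷ as) {bs} (_∷_ {s = s} {τ} p ps) with Chops-split as ps
    ... | τ₁ , τ₂ , refl , ps₁ , ps₂ =
      τ ++ τ₁ , τ₂ , sym (++-assoc τ τ₁ τ₂) , p ∷ ps₁ ,
      subst (λ t → Chops P bs t τ₂) (sym (lastOf-++ s τ τ₁)) ps₂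

Step-++ˡ : ∀ {Ψ} γ {α β} → Step Ψ α β → Step Ψ (γ ++ α) (γ ++ β)
Step-++ˡ γ (step α β φ φ∈Ψ) =
  subst₂ (Step _) (++-assoc γ α _) (++-assoc γ α _) (step (γ ++ α) β φ φ∈Ψ)

Step-++ʳ : ∀ {Ψ} δ {α β} → Step Ψ α β → Step Ψ (α ++ δ) (β ++ δ)
Step-++ʳ δ (step α β φ φ∈Ψ) =
  subst₂ (Step _) (sym (++-assoc α (𝑋 ∷ β) δ)) (sym rearrange) (step α (β ++ δ) φ φ∈Ψ)
  where
  open ≡-Reasoning
  rearrange : (α ++ grammatize φ ++ β) ++ δ ≡ α ++ grammatize φ ++ β ++ δ
  rearrange = begin
    (α ++ grammatize φ ++ β) ++ δ  ≡⟨ ++-assoc α _ δ ⟩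
    α ++ (grammatize φ ++ β) ++ δ  ≡⟨ cong (α ++_) (++-assoc (grammatize φ) β δ) ⟩
    α ++ grammatize φ ++ β ++ δ    ∎

derives-++ : ∀ {Ψ α β w₁ w₂} → Star (Step Ψ) α (map embed w₁) → Star (Step Ψ) β (map embed w₂) →
             Star (Step Ψ) (α ++ β) (map embed (w₁ ++ w₂))
derives-++ {β = β} {w₁} {w₂} α⇒*w₁ β⇒*w₂ =
  subst (Star _ _) (sym (map-++ embed w₁ w₂))
    (gmap (_++ β) (Step-++ʳ β) α⇒*w₁ ◅◅ gmap (map embed w₁ ++_) (Step-++ˡ (map embed w₁)) β⇒*w₂)

module _ {S : Set} (Q : S → S → Set) where

  data QStep : Terminal → List S → Set₁ where
    qstep : ∀ {s s'} → Q s s' → QStep R (s ∷ s' ∷ [])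

  data Along (w : List Terminal) : Trace S → Set₁ where
    along : ∀ {s τ} → Chops QStep w s τ → Along w (s ∷ τ)

  along-chop : ∀ σ {s σ' w₁ w₂} → Along w₁ (σ ++ [ s ]) → Along w₂ (s ∷ σ') →
               Along (w₁ ++ w₂) (σ ++ s ∷ σ')
  along-chop []      (along qs₁) (along qs₂) = along (Chops-++ qs₁ qs₂)
  along-chop (x ∷ σ) {s} {σ'} (along qs₁) (along qs₂) =
    along (subst (Chops QStep _ x) (++-assoc σ [ s ] σ')
      (Chops-++ qs₁ (subst (λ t → Chops QStep _ t σ') (sym (lastOf-++ x σ [ s ])) qs₂)))

module _ {S : Set} (Q : S → S → Set) (X : ℕ) (V : Val S) (Ψ : ChopFormula) where

  μ-env : Env S
  μ-env = bind X (chopForm Q X Ψ) (base V)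

  Yields : List Sym → Trace S → Set₁
  Yields α σ = Σ (List Terminal) λ w → Star (Step Ψ) α (map embed w) × Along Q w σ

  yields-chop : ∀ {a b bs σ s σ'} → Yields (a ∷ []) (σ ++ [ s ]) → Yields (b ∷ bs) (s ∷ σ') →
                Yields (a ∷ b ∷ bs) (σ ++ s ∷ σ')
  yields-chop {σ = σ} (w₁ , a⇒*w₁ , σ₁) (w₂ , bs⇒*w₂ , σ₂) =
    w₁ ++ w₂ , derives-++ a⇒*w₁ bs⇒*w₂ , along-chop Q σ σ₁ σ₂

  mutual
    sat-var⇒yields : ∀ {σ} → Sat μ-env (var X) σ → Yields (𝑋 ∷ []) σ
    sat-var⇒yields (sat-here d) with sat-disj⇒yields (List⁺.head Ψ) (List⁺.tail Ψ) d
    ... | φ , φ∈Ψ , w , φ⇒*w , σ-along = w , X⇒φ ◅ φ⇒*w , σ-along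
      where
      X⇒φ : Step Ψ (𝑋 ∷ []) (grammatize φ)
      X⇒φ = subst (Step Ψ _) (++-identityʳ (grammatize φ)) (step [] [] φ φ∈Ψ)
    sat-var⇒yields (sat-there X≢X _) = ⊥-elim (X≢X refl)

    sat-disj⇒yields : ∀ φ φs {σ} → Sat μ-env (disjForm Q X φ φs) σ →
                      Σ PrimChop λ ψ → ψ ∈ (φ ∷ φs) × Yields (grammatize ψ) σ
    sat-disj⇒yields (a ∷ as) []       d          = a ∷ as , here refl , sat-chain⇒yields a as d
    sat-disj⇒yields (a ∷ as) (_ ∷ _)  (sat-∨₁ d) = a ∷ as , here refl , sat-chain⇒yields a as d
    sat-disj⇒yields φ        (ψ ∷ φs) (sat-∨₂ d) with sat-disj⇒yields ψ φs d
    ... | χ , χ∈φs , y = χ , there χ∈φs , y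

    sat-chain⇒yields : ∀ a as {σ} → Sat μ-env (chainForm Q X a as) σ → Yields (a ∷ as) σ
    sat-chain⇒yields a []       d                = sat-sym⇒yields a d
    sat-chain⇒yields a (b ∷ bs) (sat-chop d₁ d₂) =
      yields-chop (sat-sym⇒yields a d₁) (sat-chain⇒yields b bs d₂)

    sat-sym⇒yields : ∀ a {σ} → Sat μ-env (symForm Q X a) σ → Yields (a ∷ []) σ
    sat-sym⇒yields 𝑅 (sat-rel q) = R ∷ [] , ε , along (qstep q ∷ [])
    sat-sym⇒yields 𝑋 d           = sat-var⇒yields d

  SatSym : Sym → List S → Set₁
  SatSym a = Sat μ-env (symForm Q X a)

  chops⇒sat-chain : ∀ a as {s τ} → Chops SatSym (a ∷ as) s τ → Sat μ-env (chainForm Q X a as) (s ∷ τ)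
  chops⇒sat-chain a [] {s} (_∷_ {τ = τ} d []) =
    subst (λ τ' → Sat _ _ (s ∷ τ')) (sym (++-identityʳ τ)) d
  chops⇒sat-chain a (b ∷ bs) (_∷_ {s = s} {τ} {τ'} d ds) with ∷-init-lastOf s τ
  ... | σ , s∷τ≡σ∷ʳ =
    subst (Sat _ _) (sym (trans (cong (_++ τ') s∷τ≡σ∷ʳ) (++-assoc σ _ τ')))
      (sat-chop (subst (Sat _ _) s∷τ≡σ∷ʳ d) (chops⇒sat-chain b bs ds))

  chops⇒sat-disj : ∀ φ φs ψ {s τ} → ψ ∈ (φ ∷ φs) → Chops SatSym (grammatize ψ) s τ →
                   Sat μ-env (disjForm Q X φ φs) (s ∷ τ)
  chops⇒sat-disj (a ∷ as) []       _ (here refl)  ds = chops⇒sat-chain a as ds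
  chops⇒sat-disj (a ∷ as) (_ ∷ _)  _ (here refl)  ds = sat-∨₁ (chops⇒sat-chain a as ds)
  chops⇒sat-disj _        (χ ∷ φs) ψ (there ψ∈φs) ds = sat-∨₂ (chops⇒sat-disj χ φs ψ ψ∈φs ds)

  -- A production X → φ is undone by satisfying X with the chop of the pieces of φ.
  chops-step⁻ : ∀ {α β s τ} → Step Ψ α β → Chops SatSym β s τ → Chops SatSym α s τ
  chops-step⁻ (step α β φ φ∈Ψ) ds with Chops-split α ds
  ... | _ , _ , refl , ds-α , ds-φβ with Chops-split (grammatize φ) ds-φβ
  ... | _ , _ , refl , ds-φ , ds-β =
    Chops-++ ds-α (sat-here (chops⇒sat-disj (List⁺.head Ψ) (List⁺.tail Ψ) φ φ∈Ψ ds-φ) ∷ ds-β)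

  chops-derivation⁻ : ∀ {α β s τ} → Star (Step Ψ) α β → Chops SatSym β s τ → Chops SatSym α s τ
  chops-derivation⁻ ε          ds = ds
  chops-derivation⁻ (st ◅ sts) ds = chops-step⁻ st (chops-derivation⁻ sts ds)

  chops-along : ∀ {w s τ} → Chops (QStep Q) w s τ → Chops SatSym (map embed w) s τ
  chops-along []             = []
  chops-along (qstep q ∷ qs) = sat-rel q ∷ chops-along qs

sat-bound-var⁻ : ∀ {S X Φ e} {σ : Trace S} → Sat (bind X Φ e) (var X) σ → Sat (bind X Φ e) Φ σ
sat-bound-var⁻ (sat-here d)      = d
sat-bound-var⁻ (sat-there X≢X _) = ⊥-elim (X≢X refl)

lemma5 : {S : Set} (R : S → S → Set) (X : ℕ) (V : Val S) (Ψ Ψ' : ChopFormula) →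
         (∀ (w : List Terminal) → L Ψ' w → L Ψ w) →
         ∀ (σ : Trace S) → ⟦ μ X (chopForm R X Ψ') ⟧ V σ → ⟦ μ X (chopForm R X Ψ) ⟧ V σ
lemma5 Q X V Ψ Ψ' L⊆ σ (sat-μ d) with sat-var⇒yields Q X V Ψ' (sat-here d)
... | w , X⇒*w , along {s} {τ} qs =
  sat-μ (sat-bound-var⁻ (chops⇒sat-chain Q X V Ψ 𝑋 [] X-pieces))
  where
  X-pieces : Chops (SatSym Q X V Ψ) (𝑋 ∷ []) s τ
  X-pieces = chops-derivation⁻ Q X V Ψ (L⊆ w X⇒*w) (chops-along Q X V Ψ qs)
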